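{- Let $S=S(b_1,\dots,b_k)$ be an extended star and let $m$ be a positive integer such that $S$ has an $m$-packed labeling. Then the order of $\partial_K$ acting on $\mathcal{L}_m(S)$ is $$o(\partial_K)=\begin{cases}1 & \text{if } b_i=m-1 \text{ for all } i,\\ m-1 & \text{otherwise.}\end{cases}$$
   Context: An extended star $S(b_1,\dots,b_k)$ is a poset consisting of a minimum element $\hat 0$ together with $k$ pairwise incomparable chains (branches) $B_1,\dots,B_k$ lying above $\hat0$, where $B_i$ has $b_i\ge 1$ elements; i.e. $S-\{\hat0\}$ is the disjoint union of these chains. For a positive integer $m$, an $m$-packed labeling of a finite poset $P$ is a surjection $L:P\to\{1,\dots,m\}$ such that $x<_P y$ implies $L(x)<L(y)$; $\mathcal{L}_m(P)$ is the set of them. $K$-promotion $\partial_K:\mathcal{L}_m(P)\to\mathcal{L}_m(P)$: given $L$, erase the labels of all elements labeled $1$; then for $i=2,\dots,m$ in turn, for every cover relation $x\lessdot y$ with $x$ currently unlabeled and $y$ currently labeled $i$, give $x$ label $i$ and erase the label of $y$ (simultaneously for all such pairs); finally decrease every existing label by $1$ and label every unlabeled element $m$. This is a bijection; $o(\partial_K)$ denotes its order as a permutation. -}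

module Defs where

open import Data.Nat using (ℕ; zero; suc; _+_; _∸_; _≤_; _<_; _≡ᵇ_)
open import Data.Fin using (Fin; toℕ)
open import Data.Fin.Properties using (_≟_)
open import Data.Bool using (Bool; true; false; _∧_; if_then_else_)
open import Data.Maybe using (Maybe; just; nothing; is-nothing)
open import Data.Product using (Σ; _,_; _×_; ∃)
open import Data.List using (List; _∷_; []; map; concatMap; allFin; upTo; foldl)
open import Data.Bool.ListAction using (any)
open import Data.Unit using (⊤)
open import Data.Empty using (⊥)
open import Relation.Binary.PropositionalEquality using (_≡_)
open import Relation.Nullary using (¬_)
open import Relation.Nullary.Decidable using (⌊_⌋)

-- The extended star S(b_1,…,b_k), k branches, branch i has b i elements.
-- Elements: nothing = the minimum 0̂ ; just (i , j) = the (j+1)-st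
-- element (from the bottom) of branch B_i.

SElem : (k : ℕ) → (Fin k → ℕ) → Set
SElem k b = Maybe (Σ (Fin k) (λ i → Fin (b i)))

data _<S_ {k : ℕ} {b : Fin k → ℕ} : SElem k b → SElem k b → Set where
  root<  : ∀ {i j} → nothing <S just (i , j)
  chain< : ∀ {i j j'} → toℕ j < toℕ j' → just (i , j) <S just (i , j')

cover : {k : ℕ} {b : Fin k → ℕ} → SElem k b → SElem k b → Bool
cover nothing (just (i , j)) = toℕ j ≡ᵇ 0
cover (just (i , j)) (just (i' , j')) = ⌊ i ≟ i' ⌋ ∧ (suc (toℕ j) ≡ᵇ toℕ j')
cover _ nothing = false

elems : (k : ℕ) (b : Fin k → ℕ) → List (SElem k b)
elems k b = nothing ∷ concatMap (λ i → map (λ j → just (i , j)) (allFin (b i))) (allFin k)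

Labeling : (k : ℕ) → (Fin k → ℕ) → Set
Labeling k b = SElem k b → ℕ

IsPacked : {k : ℕ} {b : Fin k → ℕ} → ℕ → Labeling k b → Set
IsPacked {k} {b} m L =
    (∀ x → 1 ≤ L x × L x ≤ m)
  × (∀ l → 1 ≤ l → l ≤ m → ∃ λ x → L x ≡ l)
  × (∀ {x y} → x <S y → L x < L y)

hasLabel : ℕ → Maybe ℕ → Bool
hasLabel i (just l) = l ≡ᵇ i
hasLabel i nothing  = false

slide : {k : ℕ} {b : Fin k → ℕ} → ℕ → (SElem k b → Maybe ℕ) → (SElem k b → Maybe ℕ)
slide {k} {b} i st x with st x
... | nothing =
  if any (λ y → cover x y ∧ hasLabel i (st y)) (elems k b) then just i else nothing
... | just l =
  if (l ≡ᵇ i) ∧ any (λ z → cover z x ∧ is-nothing (st z)) (elems k b)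
  then nothing else just l

erase1 : {k : ℕ} {b : Fin k → ℕ} → Labeling k b → (SElem k b → Maybe ℕ)
erase1 L x = if L x ≡ᵇ 1 then nothing else just (L x)

finish : {k : ℕ} {b : Fin k → ℕ} → ℕ → (SElem k b → Maybe ℕ) → Labeling k b
finish m st x with st x
... | nothing = m
... | just l  = l ∸ 1

promK : {k : ℕ} {b : Fin k → ℕ} → ℕ → Labeling k b → Labeling k b
promK m L =
  finish m (foldl (λ st i → slide i st) (erase1 L) (map (2 +_) (upTo (m ∸ 1))))

iter : {A : Set} → ℕ → (A → A) → A → A
iter zero    f a = a
iter (suc n) f a = f (iter n f a)

FixesAll : (k : ℕ) (b : Fin k → ℕ) (m t : ℕ) → Set
FixesAll k b m t = (L : Labeling k b) → IsPacked m L → ∀ x → iter t (promK m) L x ≡ L x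

IsOrderOfPromK : (k : ℕ) (b : Fin k → ℕ) (m t : ℕ) → Set
IsOrderOfPromK k b m t =
  1 ≤ t × FixesAll k b m t × (∀ s → 1 ≤ s → s < t → ¬ FixesAll k b m s)

-- On an extended star ∂_K acts branch by branch: a branch whose bottom is labelled 2 slides its
-- labels down one position, the top receiving m, and every other branch lowers its labels by 1.
-- Either way the set of labels on a branch is rotated by x ↦ x − 1 cyclically in {2, …, m}, and a
-- packed labeling is determined by these sets, so ∂_K^s fixes L exactly when every branch set is
-- invariant under rotation by s. Hence ∂_K^(m−1) is the identity, and ∂_K already is when every
-- branch has m − 1 elements and so carries all of {2, …, m}. A shorter branch misses a label y next
-- to one of its labels a; exchanging a for y (and y for a on the branch that carried y, if a is
-- needed there) gives a packed labeling whose branch set no rotation by 0 < s < m − 1 preserves.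

module Submission where

open import Defs
open import Data.Bool using (Bool; true; false; _∧_; if_then_else_)
open import Data.Bool.ListAction using (any)
open import Data.Bool.Properties using (T-≡; ∧-zeroʳ)
open import Data.Empty using (⊥)
open import Data.Fin using (Fin; toℕ; fromℕ<)
open import Data.Fin.Properties using (_≟_; fromℕ<-toℕ; toℕ-fromℕ<; toℕ<n; ¬∀⟶∃¬)
open import Data.List using (List; []; _∷_; _∷ʳ_; foldl; applyUpTo)
open import Data.List.Properties using (foldl-∷ʳ; applyUpTo-∷ʳ; map-upTo)
open import Data.List.Membership.Propositional using (_∈_)
open import Data.List.Membership.Propositional.Properties using (∈-allFin; ∈-concatMap⁺; ∈-map⁺)
open import Data.List.Relation.Unary.Any using (here; there)
open import Data.List.Relation.Unary.Any.Properties using (any⁺)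
import Data.List.Relation.Unary.Any as Any
open import Data.Maybe using (Maybe; just; nothing; is-nothing)
open import Data.Nat using (ℕ; zero; suc; _+_; _∸_; _≤_; _<_; _≡ᵇ_; _≤ᵇ_; z≤n; s≤s; _≤?_; _<?_)
open import Data.Nat.Properties hiding (_≟_)
open import Data.Nat.Properties using () renaming (_≟_ to _≟ℕ_)
open import Data.Product using (_,_; _×_; ∃; proj₁; proj₂)
open import Data.Sum using (_⊎_; inj₁; inj₂)
open import Function using (Equivalence; _⇔_; mk⇔; id; _∘′_)
open import Relation.Binary.PropositionalEquality
open import Relation.Nullary using (¬_; yes; no; Dec; contradiction)
open import Relation.Nullary.Decidable using (⌊_⌋)

≡ᵇ-true : ∀ {m n} → m ≡ n → (m ≡ᵇ n) ≡ true
≡ᵇ-true {m} {n} m≡n = Equivalence.to T-≡ (≡⇒≡ᵇ m n m≡n)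

≡ᵇ-false : ∀ {m n} → m ≢ n → (m ≡ᵇ n) ≡ false
≡ᵇ-false {m} {n} m≢n with m ≡ᵇ n in eq
... | false = refl
... | true  = contradiction (≡ᵇ⇒≡ m n (Equivalence.from T-≡ eq)) m≢n

≡ᵇ-sound : ∀ {m n} → (m ≡ᵇ n) ≡ true → m ≡ n
≡ᵇ-sound {m} {n} eq = ≡ᵇ⇒≡ m n (Equivalence.from T-≡ eq)

≤ᵇ-true : ∀ {m n} → m ≤ n → (m ≤ᵇ n) ≡ true
≤ᵇ-true m≤n = Equivalence.to T-≡ (≤⇒≤ᵇ m≤n)

≤ᵇ-false : ∀ {m n} → ¬ m ≤ n → (m ≤ᵇ n) ≡ false
≤ᵇ-false {m} {n} m≰n with m ≤ᵇ n in eq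
... | false = refl
... | true  = contradiction (≤ᵇ⇒≤ m n (Equivalence.from T-≡ eq)) m≰n

Fin-≟-refl : ∀ {n} (i : Fin n) → ⌊ i ≟ i ⌋ ≡ true
Fin-≟-refl i with i ≟ i
... | yes _  = refl
... | no i≢i = contradiction refl i≢i

if-true : ∀ {A : Set} {β : Bool} {x y : A} → β ≡ true → (if β then x else y) ≡ x
if-true refl = refl

if-false : ∀ {A : Set} {β : Bool} {x y : A} → β ≡ false → (if β then x else y) ≡ y
if-false refl = refl

∧-falseˡ : ∀ {β γ : Bool} → β ≡ false → (β ∧ γ) ≡ false
∧-falseˡ refl = refl

any-∈ : ∀ {A : Set} (p : A → Bool) {y : A} {xs : List A} → y ∈ xs → p y ≡ true → any p xs ≡ true
any-∈ p y∈xs py = Equivalence.to T-≡ (any⁺ p (Any.map (λ { refl → Equivalence.from T-≡ py }) y∈xs))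

any-none : ∀ {A : Set} (p : A → Bool) (xs : List A) → (∀ y → p y ≡ false) → any p xs ≡ false
any-none p []       _ = refl
any-none p (x ∷ xs) h rewrite h x = any-none p xs h

any-cong : ∀ {A : Set} {p q : A → Bool} (xs : List A) → p ≗ q → any p xs ≡ any q xs
any-cong []       _ = refl
any-cong (x ∷ xs) h rewrite h x | any-cong xs h = refl

iter-pull : ∀ {A : Set} s (f : A → A) x → iter s f (f x) ≡ f (iter s f x)
iter-pull zero    f x = refl
iter-pull (suc s) f x = cong f (iter-pull s f x)

iter-+ : ∀ {A : Set} s t (f : A → A) x → iter (s + t) f x ≡ iter s f (iter t f x)
iter-+ zero    t f x = refl
iter-+ (suc s) t f x = cong f (iter-+ s t f x)

IncreasingBelow : ℕ → (ℕ → ℕ) → Set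
IncreasingBelow B f = ∀ {s t} → s < t → t < B → f s < f t

IncreasingBelow-mono : ∀ {B f} → IncreasingBelow B f → ∀ {s t} → s ≤ t → t < B → f s ≤ f t
IncreasingBelow-mono increasing s≤t t<B with m≤n⇒m<n∨m≡n s≤t
... | inj₁ s<t  = <⇒≤ (increasing s<t t<B)
... | inj₂ refl = ≤-refl

ImageBelow-⊆ : ℕ → (ℕ → ℕ) → (ℕ → ℕ) → Set
ImageBelow-⊆ B f g = ∀ {s} → s < B → ∃ λ t → t < B × g t ≡ f s

-- If f t = g s with s < t, then g s = f s < f t, which is absurd; hence s ≥ t and g t ≤ g s = f t.
increasing-≤-on-agreement : ∀ {B f g} → IncreasingBelow B f → IncreasingBelow B g → ImageBelow-⊆ B f g →
  ∀ {t} → t < B → (∀ {s} → s < t → f s ≡ g s) → g t ≤ f t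
increasing-≤-on-agreement {f = f} {g} f↑ g↑ f⊆g {t} t<B agree with f⊆g t<B
... | s , s<B , gs≡ft with s <? t
... | yes s<t = contradiction (trans (agree s<t) gs≡ft) (<⇒≢ (f↑ s<t t<B))
... | no s≮t  = subst (g t ≤_) gs≡ft (IncreasingBelow-mono g↑ (≮⇒≥ s≮t) s<B)

increasing-image-injective : ∀ {B f g} → IncreasingBelow B f → IncreasingBelow B g →
  ImageBelow-⊆ B f g → ImageBelow-⊆ B g f → ∀ {t} → t < B → f t ≡ g t
increasing-image-injective {B} {f} {g} f↑ g↑ f⊆g g⊆f {t} t<B = agree-below (suc t) ≤-refl t<B
  where
  agree-below : ∀ n {t} → t < n → t < B → f t ≡ g t
  agree-below (suc n) {t} t<n+1 t<B with m≤n⇒m<n∨m≡n (≤-pred t<n+1)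
  ... | inj₁ t<n  = agree-below n t<n t<B
  ... | inj₂ refl = ≤-antisym
    (increasing-≤-on-agreement g↑ f↑ g⊆f t<B λ s<t → sym (agree-below t s<t (<-trans s<t t<B)))
    (increasing-≤-on-agreement f↑ g↑ f⊆g t<B λ s<t → agree-below t s<t (<-trans s<t t<B))

update : (ℕ → ℕ) → ℕ → ℕ → ℕ → ℕ
update f p v t = if t ≡ᵇ p then v else f t

update-≡ : ∀ f p v → update f p v p ≡ v
update-≡ f p v = if-true (≡ᵇ-true {p} refl)

update-≢ : ∀ f {p} v {t} → t ≢ p → update f p v t ≡ f t
update-≢ f v t≢p = if-false (≡ᵇ-false t≢p)

Adjacent : ℕ → ℕ → Set
Adjacent a v = a ≡ suc v ⊎ v ≡ suc a

Adjacent-sym : ∀ {a v} → Adjacent a v → Adjacent v a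
Adjacent-sym (inj₁ a≡v+1) = inj₂ a≡v+1
Adjacent-sym (inj₂ v≡a+1) = inj₁ v≡a+1

-- A value adjacent to f p that f never takes lies strictly between the neighbours of f p.
update-increasing : ∀ {B f p v} → IncreasingBelow B f → p < B → Adjacent (f p) v → (∀ {t} → t < B → f t ≢ v) →
  IncreasingBelow B (update f p v)
update-increasing {B} {f} {p} {v} f↑ p<B adjacent avoids {s} {t} s<t t<B with s ≟ℕ p | t ≟ℕ p
... | yes refl | yes refl = contradiction s<t (<-irrefl refl)
... | yes refl | no t≢p   rewrite update-≡ f p v | update-≢ f v t≢p = v<ft adjacent
  where
  fp<ft : f p < f t
  fp<ft = f↑ s<t t<B
  v<ft : Adjacent (f p) v → v < f t
  v<ft (inj₁ fp≡v+1) = <-trans (subst (v <_) (sym fp≡v+1) ≤-refl) fp<ft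
  v<ft (inj₂ v≡fp+1) = ≤∧≢⇒< (subst (_≤ f t) (sym v≡fp+1) fp<ft) (avoids t<B ∘′ sym)
... | no s≢p   | yes refl rewrite update-≢ f v s≢p | update-≡ f p v = fs<v adjacent
  where
  fs<fp : f s < f t
  fs<fp = f↑ s<t t<B
  fs<v : Adjacent (f t) v → f s < v
  fs<v (inj₁ ft≡v+1) = ≤∧≢⇒< (≤-pred (subst (f s <_) ft≡v+1 fs<fp)) (avoids (<-trans s<t t<B))
  fs<v (inj₂ v≡ft+1) = <-trans fs<fp (subst (f t <_) (sym v≡ft+1) ≤-refl)
... | no s≢p   | no t≢p   rewrite update-≢ f v s≢p | update-≢ f v t≢p = f↑ s<t t<B

-- Cyclic rotation of {2, …, m}

rot : ℕ → ℕ → ℕ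
rot m x = if x ≡ᵇ m then 2 else suc x

rot-top : ∀ m → rot m m ≡ 2
rot-top m = if-true {x = 2} {suc m} (≡ᵇ-true {m} refl)

rot-< : ∀ {m x} → x < m → rot m x ≡ suc x
rot-< {m} {x} x<m = if-false {x = 2} {suc x} (≡ᵇ-false (<⇒≢ x<m))

rot-range : ∀ {m x} → 2 ≤ x → x ≤ m → 2 ≤ rot m x × rot m x ≤ m
rot-range {m} {x} 2≤x x≤m with m≤n⇒m<n∨m≡n x≤m
... | inj₁ x<m  rewrite rot-< x<m = m≤n⇒m≤1+n 2≤x , x<m
... | inj₂ refl rewrite rot-top x = ≤-refl , 2≤x

iter-rot-+ : ∀ {m} t {x} → x + t ≤ m → iter t (rot m) x ≡ x + t
iter-rot-+ zero    {x} _ = sym (+-identityʳ x)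
iter-rot-+ {m} (suc t) {x} x+t+1≤m = begin
  rot m (iter t (rot m) x) ≡⟨ cong (rot m) (iter-rot-+ t (≤-trans (+-monoʳ-≤ x (n≤1+n t)) x+t+1≤m)) ⟩
  rot m (x + t)            ≡⟨ rot-< (subst (_≤ m) (+-suc x t) x+t+1≤m) ⟩
  suc (x + t)              ≡⟨ sym (+-suc x t) ⟩
  x + suc t                ∎
  where open ≡-Reasoning

iter-rot-wrap : ∀ {m} c {x} → x + c ≡ m → iter (suc c) (rot m) x ≡ 2
iter-rot-wrap {m} c x+c≡m = trans (cong (rot m) (trans (iter-rot-+ c (≤-reflexive x+c≡m)) x+c≡m)) (rot-top m)

m∸1-split : ∀ {m y} → 2 ≤ y → y ≤ m → m ∸ 1 ≡ (y ∸ 2) + suc (m ∸ y)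
m∸1-split {m} {y} 2≤y y≤m = begin
  m ∸ 1                       ≡⟨ cong (_∸ 1) (sym (m+[n∸m]≡n y≤m)) ⟩
  (y + (m ∸ y)) ∸ 1           ≡⟨ cong (λ z → (z + (m ∸ y)) ∸ 1) (sym (m+[n∸m]≡n 2≤y)) ⟩
  suc ((y ∸ 2) + (m ∸ y))     ≡⟨ sym (+-suc (y ∸ 2) (m ∸ y)) ⟩
  (y ∸ 2) + suc (m ∸ y)       ∎
  where open ≡-Reasoning

-- Starting from y, the orbit climbs to m in m ∸ y steps, wraps to 2, and climbs back to y.
iter-rot-period : ∀ {m y} → 2 ≤ y → y ≤ m → iter (m ∸ 1) (rot m) y ≡ y
iter-rot-period {m} {y} 2≤y y≤m = begin
  iter (m ∸ 1) (rot m) y                              ≡⟨ cong (λ s → iter s (rot m) y) (m∸1-split 2≤y y≤m) ⟩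
  iter (y ∸ 2 + suc (m ∸ y)) (rot m) y                ≡⟨ iter-+ (y ∸ 2) (suc (m ∸ y)) (rot m) y ⟩
  iter (y ∸ 2) (rot m) (iter (suc (m ∸ y)) (rot m) y) ≡⟨ cong (iter (y ∸ 2) (rot m)) (iter-rot-wrap (m ∸ y) (m+[n∸m]≡n y≤m)) ⟩
  iter (y ∸ 2) (rot m) 2                              ≡⟨ iter-rot-+ (y ∸ 2) (subst (_≤ m) (sym (m+[n∸m]≡n 2≤y)) y≤m) ⟩
  2 + (y ∸ 2)                                         ≡⟨ m+[n∸m]≡n 2≤y ⟩
  y                                                   ∎
  where open ≡-Reasoning

iter-rot-no-fixpoint : ∀ {m s y} → 1 ≤ s → s < m ∸ 1 → 2 ≤ y → y ≤ m → iter s (rot m) y ≢ y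
iter-rot-no-fixpoint {m} {s} {y} 1≤s s<m-1 2≤y y≤m with s ≤? m ∸ y
... | yes s≤c = λ eq → <⇒≢ (m<m+n y 1≤s) (sym (trans (sym (iter-rot-+ s y+s≤m)) eq))
  where
  y+s≤m : y + s ≤ m
  y+s≤m = ≤-trans (+-monoʳ-≤ y s≤c) (≤-reflexive (m+[n∸m]≡n y≤m))
... | no s≰c = λ eq → <⇒≢ (+-monoʳ-< 2 d<y-2) (trans (sym 2+d) (trans eq (sym (m+[n∸m]≡n 2≤y))))
  where
  open ≡-Reasoning
  c d : ℕ
  c = m ∸ y
  d = s ∸ suc c
  s≡d+c+1 : s ≡ d + suc c
  s≡d+c+1 = sym (m∸n+n≡m (≰⇒> s≰c))
  d<y-2 : d < y ∸ 2
  d<y-2 = +-cancelʳ-< (suc c) d (y ∸ 2) (subst₂ _<_ s≡d+c+1 (m∸1-split 2≤y y≤m) s<m-1)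
  2+d≤m : 2 + d ≤ m
  2+d≤m = ≤-trans (+-monoʳ-≤ 2 (<⇒≤ d<y-2)) (subst (_≤ m) (sym (m+[n∸m]≡n 2≤y)) y≤m)
  2+d : iter s (rot m) y ≡ 2 + d
  2+d = begin
    iter s (rot m) y                          ≡⟨ cong (λ t → iter t (rot m) y) s≡d+c+1 ⟩
    iter (d + suc c) (rot m) y                ≡⟨ iter-+ d (suc c) (rot m) y ⟩
    iter d (rot m) (iter (suc c) (rot m) y)   ≡⟨ cong (iter d (rot m)) (iter-rot-wrap c (m+[n∸m]≡n y≤m)) ⟩
    iter d (rot m) 2                          ≡⟨ iter-rot-+ d 2+d≤m ⟩
    2 + d                                     ∎

-- The state, once the labels up to c have slid, of an element labelled u whose upper neighbour is
-- labelled v, on a branch whose bottom is labelled 2.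
shifted : ℕ → ℕ → ℕ → Maybe ℕ
shifted c u v = if v ≤ᵇ c then just v else (if u ≤ᵇ c then nothing else just u)

shifted-moved : ∀ {c u v} → v ≤ c → shifted c u v ≡ just v
shifted-moved v≤c rewrite ≤ᵇ-true v≤c = refl

shifted-hole : ∀ {c u v} → ¬ v ≤ c → u ≤ c → shifted c u v ≡ nothing
shifted-hole v≰c u≤c rewrite ≤ᵇ-false v≰c | ≤ᵇ-true u≤c = refl

shifted-kept : ∀ {c u v} → ¬ v ≤ c → ¬ u ≤ c → shifted c u v ≡ just u
shifted-kept v≰c u≰c rewrite ≤ᵇ-false v≰c | ≤ᵇ-false u≰c = refl

module _ {k : ℕ} {b : Fin k → ℕ} where

  State : Set
  State = SElem k b → Maybe ℕ

  branch∈elems : ∀ i j → just (i , j) ∈ elems k b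
  branch∈elems i j = there (∈-concatMap⁺ _ (Any.map (λ { refl → ∈-map⁺ _ (∈-allFin j) }) (∈-allFin i)))

  any-cover-above : ∀ i j (q : SElem k b → Bool) (r : Bool) →
    (∀ j' → toℕ j' ≡ suc (toℕ j) → q (just (i , j')) ≡ r) → (r ≡ true → suc (toℕ j) < b i) →
    any (λ y → cover (just (i , j)) y ∧ q y) (elems k b) ≡ r
  any-cover-above i j q true above top =
    any-∈ (λ y → cover (just (i , j)) y ∧ q y) (branch∈elems i j')
      (cong₂ _∧_ (cong₂ _∧_ (Fin-≟-refl i) (≡ᵇ-true (sym (toℕ-fromℕ< (top refl))))) (above j' (toℕ-fromℕ< (top refl))))
    where j' = fromℕ< (top refl)
  any-cover-above i j q false above _ = any-none _ (elems k b) none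
    where
    none : ∀ y → (cover (just (i , j)) y ∧ q y) ≡ false
    none nothing = refl
    none (just (i' , j')) with i ≟ i'
    ... | no _ = refl
    ... | yes refl with suc (toℕ j) ≡ᵇ toℕ j' in eq
    ... | false = refl
    ... | true  = above j' (sym (≡ᵇ-sound eq))

  any-cover-below : ∀ i j (q : SElem k b → Bool) (r : Bool) → (toℕ j ≡ 0 → q nothing ≡ r) →
    (∀ t (j' : Fin (b i)) → toℕ j ≡ suc t → toℕ j' ≡ t → q (just (i , j')) ≡ r) →
    any (λ z → cover z (just (i , j)) ∧ q z) (elems k b) ≡ r
  any-cover-below i j q true bottom below = go (toℕ j) refl
    where
    go : ∀ n → toℕ j ≡ n → any (λ z → cover z (just (i , j)) ∧ q z) (elems k b) ≡ true
    go zero    j≡0 = any-∈ (λ z → cover z (just (i , j)) ∧ q z) {xs = elems k b} (here refl)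
      (cong₂ _∧_ (cong (_≡ᵇ 0) j≡0) (bottom j≡0))
    go (suc t) j≡t+1 = any-∈ (λ z → cover z (just (i , j)) ∧ q z) (branch∈elems i j')
      (cong₂ _∧_ (cong₂ _∧_ (Fin-≟-refl i) (≡ᵇ-true (trans (cong suc (toℕ-fromℕ< t<b)) (sym j≡t+1))))
                 (below t j' j≡t+1 (toℕ-fromℕ< t<b)))
      where
      t<b : t < b i
      t<b = <-trans (n<1+n t) (subst (_< b i) j≡t+1 (toℕ<n j))
      j' : Fin (b i)
      j' = fromℕ< t<b
  any-cover-below i j q false bottom below = any-none _ (elems k b) none
    where
    none : ∀ z → (cover z (just (i , j)) ∧ q z) ≡ false
    none nothing with toℕ j in eq
    ... | zero  = bottom refl
    ... | suc _ = refl
    none (just (i' , j')) with i' ≟ i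
    ... | no _ = refl
    ... | yes refl with suc (toℕ j') ≡ᵇ toℕ j in eq
    ... | false = refl
    ... | true  = below (toℕ j') j' (sym (≡ᵇ-sound eq)) refl

  any-cover-root : ∀ i j (q : SElem k b → Bool) → toℕ j ≡ 0 → q (just (i , j)) ≡ true →
    any (λ y → cover nothing y ∧ q y) (elems k b) ≡ true
  any-cover-root i j q j≡0 qy = any-∈ (λ y → cover nothing y ∧ q y) (branch∈elems i j) (cong₂ _∧_ (cong (_≡ᵇ 0) j≡0) qy)

  slide-empty : ∀ c (st : State) x → st x ≡ nothing →
    slide c st x ≡ (if any (λ y → cover x y ∧ hasLabel c (st y)) (elems k b) then just c else nothing)
  slide-empty c st x eq with st x
  ... | nothing = refl

  slide-labelled : ∀ c (st : State) x l → st x ≡ just l →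
    slide c st x ≡ (if (l ≡ᵇ c) ∧ any (λ z → cover z x ∧ is-nothing (st z)) (elems k b) then nothing else just l)
  slide-labelled c st x l eq with st x
  slide-labelled c st x .l refl | just l = refl

  slide-cong : ∀ c {st st' : State} → st ≗ st' → slide c st ≗ slide c st'
  slide-cong c {st} {st'} st≗st' x with st' x in eq
  ... | nothing rewrite slide-empty c st x (trans (st≗st' x) eq)
                      | any-cong (elems k b) (λ y → cong (λ v → cover x y ∧ hasLabel c v) (st≗st' y)) = refl
  ... | just l  rewrite slide-labelled c st x l (trans (st≗st' x) eq)
                      | any-cong (elems k b) (λ z → cong (λ v → cover z x ∧ is-nothing v) (st≗st' z)) = refl

  finish-empty : ∀ m (st : State) x → st x ≡ nothing → finish m st x ≡ m
  finish-empty m st x eq with st x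
  ... | nothing = refl

  finish-labelled : ∀ m (st : State) x l → st x ≡ just l → finish m st x ≡ l ∸ 1
  finish-labelled m st x l eq with st x
  finish-labelled m st x .l refl | just l = refl

  finish-cong : ∀ m {st st' : State} → st ≗ st' → finish m st ≗ finish m st'
  finish-cong m {st} {st'} st≗st' x with st x | st' x | st≗st' x
  ... | nothing | nothing | refl = refl
  ... | just l  | just .l | refl = refl

  promK-by-invariant : ∀ m (L : Labeling k b) (F : ℕ → State) → 1 ≤ m → erase1 L ≗ F 1 →
    (∀ c → 1 ≤ c → c < m → slide (suc c) (F c) ≗ F (suc c)) → promK m L ≗ finish m (F m)
  promK-by-invariant m L F 1≤m start step x = begin
    promK m L x
      ≡⟨ cong (λ cs → finish m (foldl slideStep (erase1 L) cs) x) (map-upTo (2 +_) (m ∸ 1)) ⟩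
    finish m (foldl slideStep (erase1 L) (applyUpTo (2 +_) (m ∸ 1))) x
      ≡⟨ finish-cong m (λ y → trans (slides (m ∸ 1) ≤-refl y) (cong (λ c → F c y) (m+[n∸m]≡n 1≤m))) x ⟩
    finish m (F m) x ∎
    where
    open ≡-Reasoning
    slideStep : State → ℕ → State
    slideStep st c = slide c st
    slides : ∀ n → n ≤ m ∸ 1 → foldl slideStep (erase1 L) (applyUpTo (2 +_) n) ≗ F (suc n)
    slides zero    _   y = start y
    slides (suc n) n<m-1 y = begin
      foldl slideStep (erase1 L) (applyUpTo (2 +_) (suc n)) y
        ≡⟨ cong (λ cs → foldl slideStep (erase1 L) cs y) (sym (applyUpTo-∷ʳ (2 +_) n)) ⟩
      foldl slideStep (erase1 L) (applyUpTo (2 +_) n ∷ʳ (2 + n)) y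
        ≡⟨ cong-app (foldl-∷ʳ slideStep (erase1 L) (2 + n) (applyUpTo (2 +_) n)) y ⟩
      slide (2 + n) (foldl slideStep (erase1 L) (applyUpTo (2 +_) n)) y
        ≡⟨ slide-cong (2 + n) (slides n (<⇒≤ n<m-1)) y ⟩
      slide (2 + n) (F (suc n)) y
        ≡⟨ step (suc n) (s≤s z≤n) (≤-trans (s≤s n<m-1) (≤-reflexive (m+[n∸m]≡n 1≤m))) y ⟩
      F (2 + n) y ∎

  -- Position t of branch i, counted from 0 at the bottom; positions past the top read m + 1.
  branchLabel : ℕ → Labeling k b → Fin k → ℕ → ℕ
  branchLabel m L i t with t <? b i
  ... | yes t<b = L (just (i , fromℕ< t<b))
  ... | no _    = suc m

  branchLabel-< : ∀ m L i t (t<b : t < b i) → branchLabel m L i t ≡ L (just (i , fromℕ< t<b))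
  branchLabel-< m L i t t<b with t <? b i
  ... | yes _  = refl
  ... | no t≮b = contradiction t<b t≮b

  branchLabel-≮ : ∀ m L i t → ¬ t < b i → branchLabel m L i t ≡ suc m
  branchLabel-≮ m L i t t≮b with t <? b i
  ... | yes t<b = contradiction t<b t≮b
  ... | no _    = refl

  branchLabel-toℕ : ∀ m L i (j : Fin (b i)) → branchLabel m L i (toℕ j) ≡ L (just (i , j))
  branchLabel-toℕ m L i j =
    trans (branchLabel-< m L i (toℕ j) (toℕ<n j)) (cong (λ j' → L (just (i , j'))) (fromℕ<-toℕ j (toℕ<n j)))

  branchLabel-cong : ∀ m {L L' : Labeling k b} → L ≗ L' → ∀ i t → branchLabel m L i t ≡ branchLabel m L' i t
  branchLabel-cong m {L} {L'} L≗L' i t with t <? b i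
  ... | yes t<b = L≗L' _
  ... | no _    = refl

  OnBranch : ℕ → Labeling k b → Fin k → ℕ → Set
  OnBranch m L i x = ∃ λ t → t < b i × branchLabel m L i t ≡ x

  OnBranch-cong : ∀ m {L L' : Labeling k b} → L ≗ L' → ∀ i x → OnBranch m L i x → OnBranch m L' i x
  OnBranch-cong m L≗L' i x (t , t<b , eq) = t , t<b , trans (sym (branchLabel-cong m L≗L' i t)) eq

  IsPacked-cong : ∀ {m} {L L' : Labeling k b} → L ≗ L' → IsPacked m L → IsPacked m L'
  IsPacked-cong {m} L≗L' (bounded , onto , monotone) =
    (λ x → subst (λ l → 1 ≤ l × l ≤ m) (L≗L' x) (bounded x)) ,
    (λ l 1≤l l≤m → let (x , eq) = onto l 1≤l l≤m in x , trans (sym (L≗L' x)) eq) ,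
    (λ {x} {y} x<y → subst₂ _<_ (L≗L' x) (L≗L' y) (monotone x<y))

  module Packed {m : ℕ} {L : Labeling k b} (packed : IsPacked m L) where

    private
      ℓ : Fin k → ℕ → ℕ
      ℓ = branchLabel m L
      bounded : ∀ x → 1 ≤ L x × L x ≤ m
      bounded = proj₁ packed
      onto : ∀ l → 1 ≤ l → l ≤ m → ∃ λ x → L x ≡ l
      onto = proj₁ (proj₂ packed)
      monotone : ∀ {x y} → x <S y → L x < L y
      monotone = proj₂ (proj₂ packed)

    1≤m : 1 ≤ m
    1≤m = ≤-trans (proj₁ (bounded nothing)) (proj₂ (bounded nothing))

    root-label : L nothing ≡ 1
    root-label with onto 1 ≤-refl 1≤m
    ... | nothing , eq = eq
    ... | just (_ , j) , eq = contradiction (subst (L nothing <_) eq (monotone (root< {j = j}))) (≤⇒≯ (proj₁ (bounded nothing)))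

    2≤label : ∀ i j → 2 ≤ L (just (i , j))
    2≤label i j = subst (_< L (just (i , j))) root-label (monotone root<)

    label-on-branch : ∀ l → 2 ≤ l → l ≤ m → ∃ λ i → OnBranch m L i l
    label-on-branch l 2≤l l≤m with onto l (<⇒≤ 2≤l) l≤m
    ... | nothing , eq       = contradiction (trans (sym eq) root-label) (<⇒≢ 2≤l ∘′ sym)
    ... | just (i , j) , eq = i , toℕ j , toℕ<n j , trans (branchLabel-toℕ m L i j) eq

    branch-≤ : ∀ i t → t < b i → ℓ i t ≤ m
    branch-≤ i t t<b rewrite branchLabel-< m L i t t<b = proj₂ (bounded _)

    branch-≤1+ : ∀ i t → ℓ i t ≤ suc m
    branch-≤1+ i t with t <? b i
    ... | yes t<b = m≤n⇒m≤1+n (proj₂ (bounded _))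
    ... | no _    = ≤-refl

    inside-branch : ∀ i t → ℓ i t ≤ m → t < b i
    inside-branch i t ℓ≤m = decide (t <? b i)
      where
      decide : Dec (t < b i) → t < b i
      decide (yes t<b) = t<b
      decide (no t≮b)  = contradiction (subst (_≤ m) (branchLabel-≮ m L i t t≮b) ℓ≤m) (1+n≰n)

    branch-≥2 : ∀ i t → 2 ≤ ℓ i t
    branch-≥2 i t with t <? b i
    ... | yes _ = 2≤label i _
    ... | no _  = s≤s 1≤m

    branch-< : ∀ i {s t} → s < t → s < b i → ℓ i s < ℓ i t
    branch-< i {s} {t} s<t s<b with t <? b i
    ... | no _    = s≤s (branch-≤ i s s<b)
    ... | yes t<b rewrite branchLabel-< m L i s s<b =
      monotone (chain< (subst₂ _<_ (sym (toℕ-fromℕ< s<b)) (sym (toℕ-fromℕ< t<b)) s<t))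

    branch-increasing : ∀ i → IncreasingBelow (b i) (ℓ i)
    branch-increasing i s<t t<b = branch-< i s<t (<-trans s<t t<b)

    branch-mono : ∀ i {s t} → s ≤ t → ℓ i s ≤ ℓ i t
    branch-mono i {s} {t} s≤t with m≤n⇒m<n∨m≡n s≤t
    ... | inj₂ refl = ≤-refl
    ... | inj₁ s<t  = by-cases (s <? b i)
      where
      by-cases : Dec (s < b i) → ℓ i s ≤ ℓ i t
      by-cases (yes s<b) = <⇒≤ (branch-< i s<t s<b)
      by-cases (no s≮b)  = ≤-reflexive (trans (branchLabel-≮ m L i s s≮b) (sym (branchLabel-≮ m L i t (s≮b ∘′ <-trans s<t))))

    branch-gap : ∀ i s d → s + d < b i → ℓ i s + d ≤ ℓ i (s + d)
    branch-gap i s zero    _ rewrite +-identityʳ s | +-identityʳ (ℓ i s) = ≤-refl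
    branch-gap i s (suc d) s+d+1<b rewrite +-suc (ℓ i s) d | +-suc s d =
      ≤-trans (s≤s (branch-gap i s d s+d<b)) (branch-< i (n<1+n (s + d)) s+d<b)
      where
      s+d<b : s + d < b i
      s+d<b = <-trans (n<1+n (s + d)) s+d+1<b

    2+≤branch : ∀ i t → t < b i → 2 + t ≤ ℓ i t
    2+≤branch i t t<b = ≤-trans (+-monoˡ-≤ t (branch-≥2 i 0)) (branch-gap i 0 t t<b)

    branch-length-≤ : ∀ i → b i ≤ m ∸ 1
    branch-length-≤ i with b i in eq
    ... | zero  = z≤n
    ... | suc n = ∸-monoˡ-≤ 1 (≤-trans (2+≤branch i n n<b) (branch-≤ i n n<b))
      where
      n<b : n < b i
      n<b = subst (n <_) (sym eq) ≤-refl

    full-branch : ∀ i → b i ≡ m ∸ 1 → ∀ t → t < b i → ℓ i t ≡ 2 + t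
    full-branch i full t t<b = ≤-antisym (+-cancelʳ-≤ d (ℓ i t) (2 + t) ℓt+d≤2+t+d) (2+≤branch i t t<b)
      where
      d : ℕ
      d = b i ∸ suc t
      t+d+1≡b : suc t + d ≡ b i
      t+d+1≡b = m+[n∸m]≡n t<b
      ℓt+d≤2+t+d : ℓ i t + d ≤ 2 + t + d
      ℓt+d≤2+t+d = begin
        ℓ i t + d      ≤⟨ branch-gap i t d (≤-reflexive t+d+1≡b) ⟩
        ℓ i (t + d)    ≤⟨ branch-≤ i (t + d) (≤-reflexive t+d+1≡b) ⟩
        m              ≡⟨ sym (m+[n∸m]≡n 1≤m) ⟩
        suc (m ∸ 1)    ≡⟨ cong suc (trans (sym full) (sym t+d+1≡b)) ⟩
        2 + t + d      ∎
        where open ≤-Reasoning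

    full-branch-OnBranch : ∀ i → b i ≡ m ∸ 1 → ∀ x → 2 ≤ x → x ≤ m → OnBranch m L i x
    full-branch-OnBranch i full x 2≤x x≤m = x ∸ 2 , t<b , trans (full-branch i full (x ∸ 2) t<b) (m+[n∸m]≡n 2≤x)
      where
      t<b : x ∸ 2 < b i
      t<b = subst (x ∸ 2 <_) (sym full) (≤-trans (≤-reflexive (sym (+-∸-assoc 1 2≤x))) (∸-monoˡ-≤ 1 x≤m))

    label-2-at-bottom : ∀ i {t} → ℓ i t ≡ 2 → ℓ i 0 ≡ 2
    label-2-at-bottom i ℓt≡2 = ≤-antisym (subst (ℓ i 0 ≤_) ℓt≡2 (branch-mono i z≤n)) (branch-≥2 i 0)

    bottom-labelled-2 : 2 ≤ m → ∃ λ i → 0 < b i × ℓ i 0 ≡ 2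
    bottom-labelled-2 2≤m with label-on-branch 2 ≤-refl 2≤m
    ... | i , t , t<b , ℓt≡2 = i , ≤-<-trans z≤n t<b , label-2-at-bottom i ℓt≡2

  -- The explicit form of ∂_K

  startsAt2 : ℕ → Labeling k b → Fin k → Bool
  startsAt2 m L i = branchLabel m L i 0 ≡ᵇ 2

  fromBranches : (Fin k → ℕ → ℕ) → Labeling k b
  fromBranches g nothing        = 1
  fromBranches g (just (i , j)) = g i (toℕ j)

  branchLabel-fromBranches : ∀ m g i t → t < b i → branchLabel m (fromBranches g) i t ≡ g i t
  branchLabel-fromBranches m g i t t<b = trans (branchLabel-< m (fromBranches g) i t t<b) (cong (g i) (toℕ-fromℕ< t<b))

  fromBranches-packed : ∀ {m} g → 1 ≤ m → (∀ i t → t < b i → 2 ≤ g i t × g i t ≤ m) →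
    (∀ i → IncreasingBelow (b i) (g i)) → (∀ l → 2 ≤ l → l ≤ m → ∃ λ i → OnBranch m (fromBranches g) i l) →
    IsPacked m (fromBranches g)
  fromBranches-packed {m} g 1≤m range increasing covered = bounded , onto , monotone
    where
    bounded : ∀ x → 1 ≤ fromBranches g x × fromBranches g x ≤ m
    bounded nothing        = ≤-refl , 1≤m
    bounded (just (i , j)) = let (2≤g , g≤m) = range i (toℕ j) (toℕ<n j) in <⇒≤ 2≤g , g≤m
    onto : ∀ l → 1 ≤ l → l ≤ m → ∃ λ x → fromBranches g x ≡ l
    onto l 1≤l l≤m with m≤n⇒m<n∨m≡n 1≤l
    ... | inj₂ 1≡l = nothing , 1≡l
    ... | inj₁ 2≤l with covered l 2≤l l≤m
    ... | i , t , t<b , eq = just (i , fromℕ< t<b) , trans (sym (branchLabel-< m (fromBranches g) i t t<b)) eq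
    monotone : ∀ {x y} → x <S y → fromBranches g x < fromBranches g y
    monotone (root< {i} {j})         = proj₁ (range i (toℕ j) (toℕ<n j))
    monotone (chain< {i} {j} {j'} p) = increasing i p (toℕ<n j')

  promoted : ℕ → Labeling k b → Labeling k b
  promoted m L = fromBranches λ i t →
    if startsAt2 m L i then branchLabel m L i (suc t) ∸ 1 else branchLabel m L i t ∸ 1

  module Promotion {m : ℕ} {L : Labeling k b} (packed : IsPacked m L) where

    open Packed packed
    private
      ℓ : Fin k → ℕ → ℕ
      ℓ = branchLabel m L
      starts : Fin k → Bool
      starts = startsAt2 m L

    starts-true : ∀ {i} → starts i ≡ true → ℓ i 0 ≡ 2
    starts-true = ≡ᵇ-sound

    starts-false : ∀ {i} → starts i ≡ false → ℓ i 0 ≢ 2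
    starts-false starts≡false ℓ0≡2 with () ← trans (sym (≡ᵇ-true ℓ0≡2)) starts≡false

    -- The state after the slides of the labels 2, …, c; c = 1 is the state right after erasing
    -- the 1s. On a branch starting at 2 a hole climbs the branch: every element whose upper
    -- neighbour carries a label ≤ c has taken over that label.
    sliding : ℕ → State
    sliding c nothing        = if 2 ≤ᵇ c then just 2 else nothing
    sliding c (just (i , j)) =
      if starts i then shifted c (ℓ i (toℕ j)) (ℓ i (suc (toℕ j))) else just (ℓ i (toℕ j))

    sliding-root-2 : ∀ {c} → 2 ≤ c → sliding c nothing ≡ just 2
    sliding-root-2 2≤c rewrite ≤ᵇ-true 2≤c = refl

    sliding-root-empty : ∀ {c} → ¬ 2 ≤ c → sliding c nothing ≡ nothing
    sliding-root-empty 2≰c rewrite ≤ᵇ-false 2≰c = refl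

    sliding-starting : ∀ c i (j : Fin (b i)) {t} → starts i ≡ true → toℕ j ≡ t →
      sliding c (just (i , j)) ≡ shifted c (ℓ i t) (ℓ i (suc t))
    sliding-starting c i j starts-i refl = if-true starts-i

    sliding-other : ∀ c i (j : Fin (b i)) {t} → starts i ≡ false → toℕ j ≡ t → sliding c (just (i , j)) ≡ just (ℓ i t)
    sliding-other c i j starts-i refl = if-false starts-i

    private
      ≰suc : ∀ {v c} → ¬ v ≤ c → v ≢ suc c → ¬ v ≤ suc c
      ≰suc v≰c v≢c+1 v≤c+1 with m≤n⇒m<n∨m≡n v≤c+1
      ... | inj₁ v<c+1   = v≰c (≤-pred v<c+1)
      ... | inj₂ v≡c+1   = v≢c+1 v≡c+1

      t<b-below : ∀ i (j : Fin (b i)) {t} → toℕ j ≡ suc t → t < b i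
      t<b-below i j {t} j≡t+1 = <-trans (n<1+n t) (subst (_< b i) j≡t+1 (toℕ<n j))

    slide-other : ∀ c → 1 ≤ c → ∀ i j → starts i ≡ false →
      slide (suc c) (sliding c) (just (i , j)) ≡ just (ℓ i (toℕ j))
    slide-other c 1≤c i j starts-i =
      trans (slide-labelled (suc c) (sliding c) (just (i , j)) u (sliding-other c i j starts-i refl)) (if-false stays)
      where
      u = ℓ i (toℕ j)
      empty : SElem k b → Bool
      empty z = is-nothing (sliding c z)
      stays : ((u ≡ᵇ suc c) ∧ any (λ z → cover z (just (i , j)) ∧ empty z) (elems k b)) ≡ false
      stays with u ≟ℕ suc c
      ... | no u≢c+1  = ∧-falseˡ (≡ᵇ-false u≢c+1)
      ... | yes u≡c+1 = trans (cong (_ ∧_) (any-cover-below i j empty false root-filled below-filled)) (∧-zeroʳ _)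
        where
        -- the bottom label of this branch is not 2, so the root is refilled before u = c + 1 slides
        root-filled : toℕ j ≡ 0 → empty nothing ≡ false
        root-filled j≡0 with m≤n⇒m<n∨m≡n 1≤c
        ... | inj₁ 2≤c = cong is-nothing (sliding-root-2 2≤c)
        ... | inj₂ 1≡c = contradiction (trans (cong (ℓ i) (sym j≡0)) (trans u≡c+1 (cong suc (sym 1≡c)))) (starts-false starts-i)
        below-filled : ∀ t j' → toℕ j ≡ suc t → toℕ j' ≡ t → empty (just (i , j')) ≡ false
        below-filled t j' _ j'≡t = cong is-nothing (sliding-other c i j' starts-i j'≡t)

    module Starting (c : ℕ) (c<m : c < m) (i : Fin k) (starts-i : starts i ≡ true) (j : Fin (b i)) where

      private
        x : SElem k b
        x = just (i , j)
        u v : ℕ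
        u = ℓ i (toℕ j)
        v = ℓ i (suc (toℕ j))

      u<v : u < v
      u<v = branch-< i (n<1+n (toℕ j)) (toℕ<n j)

      state : sliding c x ≡ shifted c u v
      state = sliding-starting c i j starts-i refl

      above-holds-v : ¬ v ≤ c → ∀ j' → toℕ j' ≡ suc (toℕ j) → sliding c (just (i , j')) ≡ just v
      above-holds-v v≰c j' j'≡j+1 =
        trans (sliding-starting c i j' starts-i j'≡j+1) (shifted-kept (v≰c ∘′ ≤-trans (branch-mono i (n≤1+n _))) v≰c)

      slide-moved : v ≤ c → slide (suc c) (sliding c) x ≡ shifted (suc c) u v
      slide-moved v≤c = begin
        slide (suc c) (sliding c) x ≡⟨ slide-labelled (suc c) (sliding c) x v (trans state (shifted-moved v≤c)) ⟩
        _                           ≡⟨ if-false (∧-falseˡ (≡ᵇ-false (<⇒≢ (s≤s v≤c)))) ⟩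
        just v                      ≡⟨ sym (shifted-moved (m≤n⇒m≤1+n v≤c)) ⟩
        shifted (suc c) u v         ∎
        where open ≡-Reasoning

      slide-hole : ¬ v ≤ c → u ≤ c → slide (suc c) (sliding c) x ≡ shifted (suc c) u v
      slide-hole v≰c u≤c with v ≟ℕ suc c
      ... | yes v≡c+1 = begin
        slide (suc c) (sliding c) x ≡⟨ slide-empty (suc c) (sliding c) x (trans state (shifted-hole v≰c u≤c)) ⟩
        _                           ≡⟨ if-true (any-cover-above i j carries-c+1 true above top) ⟩
        just (suc c)                ≡⟨ cong just (sym v≡c+1) ⟩
        just v                      ≡⟨ sym (shifted-moved (≤-reflexive v≡c+1)) ⟩
        shifted (suc c) u v         ∎
        where
        open ≡-Reasoning
        carries-c+1 : SElem k b → Bool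
        carries-c+1 y = hasLabel (suc c) (sliding c y)
        above : ∀ j' → toℕ j' ≡ suc (toℕ j) → carries-c+1 (just (i , j')) ≡ true
        above j' j'≡j+1 = trans (cong (hasLabel (suc c)) (above-holds-v v≰c j' j'≡j+1)) (≡ᵇ-true v≡c+1)
        top : true ≡ true → suc (toℕ j) < b i
        top _ = inside-branch i (suc (toℕ j)) (subst (_≤ m) (sym v≡c+1) c<m)
      ... | no v≢c+1 = begin
        slide (suc c) (sliding c) x ≡⟨ slide-empty (suc c) (sliding c) x (trans state (shifted-hole v≰c u≤c)) ⟩
        _                           ≡⟨ if-false (any-cover-above i j carries-c+1 false above λ ()) ⟩
        nothing                     ≡⟨ sym (shifted-hole (≰suc v≰c v≢c+1) (m≤n⇒m≤1+n u≤c)) ⟩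
        shifted (suc c) u v         ∎
        where
        open ≡-Reasoning
        carries-c+1 : SElem k b → Bool
        carries-c+1 y = hasLabel (suc c) (sliding c y)
        above : ∀ j' → toℕ j' ≡ suc (toℕ j) → carries-c+1 (just (i , j')) ≡ false
        above j' j'≡j+1 = trans (cong (hasLabel (suc c)) (above-holds-v v≰c j' j'≡j+1)) (≡ᵇ-false v≢c+1)

      slide-vacated : ¬ u ≤ c → u ≡ suc c → slide (suc c) (sliding c) x ≡ shifted (suc c) u v
      slide-vacated u≰c u≡c+1 = begin
        slide (suc c) (sliding c) x ≡⟨ slide-labelled (suc c) (sliding c) x u (trans state (shifted-kept v≰c u≰c)) ⟩
        _                           ≡⟨ if-true (cong₂ _∧_ (≡ᵇ-true u≡c+1) (any-cover-below i j empty true root-empty below-empty)) ⟩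
        nothing                     ≡⟨ sym (shifted-hole v≰c+1 (≤-reflexive u≡c+1)) ⟩
        shifted (suc c) u v         ∎
        where
        open ≡-Reasoning
        empty : SElem k b → Bool
        empty z = is-nothing (sliding c z)
        v≰c+1 : ¬ v ≤ suc c
        v≰c+1 v≤c+1 = <⇒≱ u<v (subst (v ≤_) (sym u≡c+1) v≤c+1)
        v≰c : ¬ v ≤ c
        v≰c = v≰c+1 ∘′ m≤n⇒m≤1+n
        -- at the bottom, u = 2 forces c = 1, when the root is still empty
        root-empty : toℕ j ≡ 0 → empty nothing ≡ true
        root-empty j≡0 = cong is-nothing (sliding-root-empty λ 2≤c →
          <⇒≱ (s≤s 2≤c) (≤-reflexive (trans (sym u≡c+1) (trans (cong (ℓ i) j≡0) (starts-true starts-i)))))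
        below-empty : ∀ t j' → toℕ j ≡ suc t → toℕ j' ≡ t → empty (just (i , j')) ≡ true
        below-empty t j' j≡t+1 j'≡t = cong is-nothing (trans (sliding-starting c i j' starts-i j'≡t)
          (shifted-hole (u≰c ∘′ subst (λ s → ℓ i s ≤ c) (sym j≡t+1)) ℓt≤c))
          where
          ℓt≤c : ℓ i t ≤ c
          ℓt≤c = ≤-pred (subst (ℓ i t <_) u≡c+1
            (subst (λ s → ℓ i t < ℓ i s) (sym j≡t+1) (branch-< i (n<1+n t) (t<b-below i j j≡t+1))))

      slide-kept : ¬ u ≤ c → u ≢ suc c → slide (suc c) (sliding c) x ≡ shifted (suc c) u v
      slide-kept u≰c u≢c+1 = begin
        slide (suc c) (sliding c) x ≡⟨ slide-labelled (suc c) (sliding c) x u (trans state (shifted-kept v≰c u≰c)) ⟩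
        _                           ≡⟨ if-false (∧-falseˡ (≡ᵇ-false u≢c+1)) ⟩
        just u                      ≡⟨ sym (shifted-kept (u≰c+1 ∘′ ≤-trans (<⇒≤ u<v)) u≰c+1) ⟩
        shifted (suc c) u v         ∎
        where
        open ≡-Reasoning
        u≰c+1 : ¬ u ≤ suc c
        u≰c+1 = ≰suc u≰c u≢c+1
        v≰c : ¬ v ≤ c
        v≰c = u≰c ∘′ ≤-trans (<⇒≤ u<v)

      slide-starting : slide (suc c) (sliding c) x ≡ shifted (suc c) u v
      slide-starting with v ≤? c | u ≤? c
      ... | yes v≤c | _       = slide-moved v≤c
      ... | no v≰c  | yes u≤c = slide-hole v≰c u≤c
      ... | no _    | no u≰c  with u ≟ℕ suc c
      ...   | yes u≡c+1 = slide-vacated u≰c u≡c+1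
      ...   | no u≢c+1  = slide-kept u≰c u≢c+1

    slide-root : ∀ c → 1 ≤ c → c < m → slide (suc c) (sliding c) nothing ≡ sliding (suc c) nothing
    slide-root (suc zero) _ 1<m with bottom-labelled-2 1<m
    ... | i , 0<b , ℓ0≡2 = trans (slide-empty 2 (sliding 1) nothing refl) (if-true (any-cover-root i j carries-2 j≡0 bottom-carries-2))
      where
      j : Fin (b i)
      j = fromℕ< 0<b
      j≡0 : toℕ j ≡ 0
      j≡0 = toℕ-fromℕ< 0<b
      carries-2 : SElem k b → Bool
      carries-2 y = hasLabel 2 (sliding 1 y)
      ℓ≰1 : ∀ t → ¬ ℓ i t ≤ 1
      ℓ≰1 t = <⇒≱ (branch-≥2 i t)
      bottom-carries-2 : carries-2 (just (i , j)) ≡ true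
      bottom-carries-2 = trans
        (cong (hasLabel 2) (trans (sliding-starting 1 i j (≡ᵇ-true ℓ0≡2) j≡0) (shifted-kept (ℓ≰1 1) (ℓ≰1 0))))
                               (≡ᵇ-true ℓ0≡2)
    slide-root (suc (suc c)) _ _ = slide-labelled (3 + c) (sliding (2 + c)) nothing 2 refl

    slide-sliding : ∀ c → 1 ≤ c → c < m → slide (suc c) (sliding c) ≗ sliding (suc c)
    slide-sliding c 1≤c c<m nothing = slide-root c 1≤c c<m
    slide-sliding c 1≤c c<m (just (i , j)) = by-start (starts i) refl
      where
      by-start : ∀ β → starts i ≡ β → slide (suc c) (sliding c) (just (i , j)) ≡ sliding (suc c) (just (i , j))
      by-start true  starts-i = trans (Starting.slide-starting c c<m i starts-i j) (sym (sliding-starting (suc c) i j starts-i refl))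
      by-start false starts-i = trans (slide-other c 1≤c i j starts-i) (sym (sliding-other (suc c) i j starts-i refl))

    erase1-sliding : erase1 L ≗ sliding 1
    erase1-sliding nothing rewrite root-label = refl
    erase1-sliding (just (i , j)) = trans (if-false (≡ᵇ-false (<⇒≢ (2≤label i j) ∘′ sym))) (by-start (starts i) refl)
      where
      ℓ≰1 : ∀ t → ¬ ℓ i t ≤ 1
      ℓ≰1 t = <⇒≱ (branch-≥2 i t)
      by-start : ∀ β → starts i ≡ β → just (L (just (i , j))) ≡ sliding 1 (just (i , j))
      by-start true  starts-i = trans (cong just (sym (branchLabel-toℕ m L i j)))
        (sym (trans (sliding-starting 1 i j starts-i refl) (shifted-kept (ℓ≰1 _) (ℓ≰1 _))))
      by-start false starts-i = trans (cong just (sym (branchLabel-toℕ m L i j))) (sym (sliding-other 1 i j starts-i refl))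

    finish-sliding : finish m (sliding m) ≗ promoted m L
    finish-sliding nothing with m≤n⇒m<n∨m≡n 1≤m
    ... | inj₁ 2≤m = finish-labelled m (sliding m) nothing 2 (sliding-root-2 2≤m)
    ... | inj₂ 1≡m = trans (finish-empty m (sliding m) nothing (sliding-root-empty (1+n≰n ∘′ subst (2 ≤_) (sym 1≡m)))) (sym 1≡m)
    finish-sliding (just (i , j)) = by-start (starts i) refl
      where
      x = just (i , j)
      by-start : ∀ β → starts i ≡ β → finish m (sliding m) x ≡ promoted m L x
      by-start false starts-i = trans (finish-labelled m (sliding m) x _ (sliding-other m i j starts-i refl)) (sym (if-false starts-i))
      by-start true  starts-i = trans (at-top (suc (toℕ j) <? b i)) (sym (if-true starts-i))
        where
        at-top : Dec (suc (toℕ j) < b i) → finish m (sliding m) x ≡ ℓ i (suc (toℕ j)) ∸ 1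
        at-top (yes j+1<b) = finish-labelled m (sliding m) x _
          (trans (sliding-starting m i j starts-i refl) (shifted-moved (branch-≤ i _ j+1<b)))
        at-top (no j+1≮b)  = trans (finish-empty m (sliding m) x (trans (sliding-starting m i j starts-i refl)
            (shifted-hole (1+n≰n ∘′ subst (_≤ m) (branchLabel-≮ m L i _ j+1≮b)) (branch-≤ i _ (toℕ<n j)))))
          (cong (_∸ 1) (sym (branchLabel-≮ m L i _ j+1≮b)))

    promK≗promoted : promK m L ≗ promoted m L
    promK≗promoted x =
      trans (promK-by-invariant m L sliding 1≤m erase1-sliding slide-sliding x) (finish-sliding x)

    private
      pred-≡ : ∀ {a x} → 1 ≤ a → a ∸ 1 ≡ x → a ≡ suc x
      pred-≡ 1≤a eq = trans (sym (m+[n∸m]≡n 1≤a)) (cong suc eq)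

      branch-pred-≡ : ∀ i t {x} → ℓ i t ∸ 1 ≡ x → ℓ i t ≡ suc x
      branch-pred-≡ i t = pred-≡ (<⇒≤ (branch-≥2 i t))

    promoted-branch : ∀ i t → t < b i →
      branchLabel m (promoted m L) i t ≡ (if starts i then ℓ i (suc t) ∸ 1 else ℓ i t ∸ 1)
    promoted-branch i t = branchLabel-fromBranches m _ i t

    promoted-OnBranch⁻ : ∀ i {x} → OnBranch m (promoted m L) i x → OnBranch m L i (rot m x)
    promoted-OnBranch⁻ i {x} (t , t<b , eq) = by-start (starts i) refl
      where
      by-start : ∀ β → starts i ≡ β → OnBranch m L i (rot m x)
      by-start false starts-i = t , t<b , trans ℓt≡x+1 (sym (rot-< (subst (_≤ m) ℓt≡x+1 (branch-≤ i t t<b))))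
        where
        ℓt≡x+1 : ℓ i t ≡ suc x
        ℓt≡x+1 = branch-pred-≡ i t (trans (sym (trans (promoted-branch i t t<b) (if-false starts-i))) eq)
      by-start true starts-i = at-top (suc t <? b i)
        where
        ℓt+1≡x+1 : ℓ i (suc t) ≡ suc x
        ℓt+1≡x+1 = branch-pred-≡ i (suc t) (trans (sym (trans (promoted-branch i t t<b) (if-true starts-i))) eq)
        at-top : Dec (suc t < b i) → OnBranch m L i (rot m x)
        at-top (yes t+1<b) = suc t , t+1<b , trans ℓt+1≡x+1 (sym (rot-< (subst (_≤ m) ℓt+1≡x+1 (branch-≤ i _ t+1<b))))
        at-top (no t+1≮b)  = 0 , ≤-<-trans z≤n t<b , trans (starts-true starts-i) (sym (trans (cong (rot m) x≡m) (rot-top m)))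
          where
          x≡m : x ≡ m
          x≡m = suc-injective (trans (sym ℓt+1≡x+1) (branchLabel-≮ m L i _ t+1≮b))

    promoted-OnBranch⁺ : ∀ i {x} → 2 ≤ x → x ≤ m → OnBranch m L i (rot m x) → OnBranch m (promoted m L) i x
    promoted-OnBranch⁺ i {x} 2≤x x≤m (t , t<b , eq) with m≤n⇒m<n∨m≡n x≤m
    ... | inj₂ x≡m = b i ∸ 1 , top<b , top-label
      where
      open ≡-Reasoning
      ℓt≡2 : ℓ i t ≡ 2
      ℓt≡2 = trans eq (trans (cong (rot m) x≡m) (rot-top m))
      1≤b : 1 ≤ b i
      1≤b = ≤-<-trans z≤n t<b
      top<b : b i ∸ 1 < b i
      top<b = ≤-reflexive (m+[n∸m]≡n 1≤b)
      top-label : branchLabel m (promoted m L) i (b i ∸ 1) ≡ x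
      top-label = begin
        branchLabel m (promoted m L) i (b i ∸ 1) ≡⟨ promoted-branch i _ top<b ⟩
        _                                        ≡⟨ if-true (≡ᵇ-true (label-2-at-bottom i ℓt≡2)) ⟩
        ℓ i (suc (b i ∸ 1)) ∸ 1                  ≡⟨ cong (λ s → ℓ i s ∸ 1) (m+[n∸m]≡n 1≤b) ⟩
        ℓ i (b i) ∸ 1                            ≡⟨ cong (_∸ 1) (branchLabel-≮ m L i (b i) (<-irrefl refl)) ⟩
        m                                        ≡⟨ sym x≡m ⟩
        x                                        ∎
    ... | inj₁ x<m = by-start (starts i) refl
      where
      ℓt≡x+1 : ℓ i t ≡ suc x
      ℓt≡x+1 = trans eq (rot-< x<m)
      by-start : ∀ β → starts i ≡ β → OnBranch m (promoted m L) i x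
      by-start false starts-i = t , t<b , trans (promoted-branch i t t<b) (trans (if-false starts-i) (cong (_∸ 1) ℓt≡x+1))
      by-start true  starts-i = one-below t t<b ℓt≡x+1
        where
        one-below : ∀ t → t < b i → ℓ i t ≡ suc x → OnBranch m (promoted m L) i x
        one-below zero     _   ℓ0≡x+1 =
          contradiction (suc-injective (trans (sym ℓ0≡x+1) (starts-true starts-i))) (<⇒≢ 2≤x ∘′ sym)
        one-below (suc t') t<b ℓt≡x+1 = t' , <-trans (n<1+n t') t<b ,
          trans (promoted-branch i t' (<-trans (n<1+n t') t<b)) (trans (if-true starts-i) (cong (_∸ 1) ℓt≡x+1))

    promoted-packed : IsPacked m (promoted m L)
    promoted-packed = fromBranches-packed _ 1≤m range increasing covered
      where
      g : Fin k → ℕ → ℕ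
      g i t = if starts i then ℓ i (suc t) ∸ 1 else ℓ i t ∸ 1
      3≤⇒2≤pred : ∀ {a} → 3 ≤ a → 2 ≤ a ∸ 1
      3≤⇒2≤pred = ∸-monoˡ-≤ 1
      range : ∀ i t → t < b i → 2 ≤ g i t × g i t ≤ m
      range i t t<b with starts i in starts-i
      ... | true  = 3≤⇒2≤pred (subst (_< ℓ i (suc t)) (starts-true starts-i) (branch-< i (s≤s z≤n) (≤-<-trans z≤n t<b))) ,
                    ∸-monoˡ-≤ 1 (branch-≤1+ i (suc t))
      ... | false = 3≤⇒2≤pred (≤-trans (≤∧≢⇒< (branch-≥2 i 0) (starts-false starts-i ∘′ sym)) (branch-mono i z≤n)) ,
                    ∸-monoˡ-≤ 1 (branch-≤1+ i t)
      increasing : ∀ i → IncreasingBelow (b i) (g i)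
      increasing i {s} {t} s<t t<b with starts i
      ... | true  = ∸-monoˡ-< (branch-< i (s≤s s<t) (<-≤-trans (s≤s s<t) t<b)) (<⇒≤ (branch-≥2 i _))
      ... | false = ∸-monoˡ-< (branch-< i s<t (<-trans s<t t<b)) (<⇒≤ (branch-≥2 i _))
      covered : ∀ l → 2 ≤ l → l ≤ m → ∃ λ i → OnBranch m (promoted m L) i l
      covered l 2≤l l≤m =
        let (2≤rot , rot≤m) = rot-range 2≤l l≤m
            (i , rot-on-i) = label-on-branch (rot m l) 2≤rot rot≤m
        in i , promoted-OnBranch⁺ i 2≤l l≤m rot-on-i

  promK-packed : ∀ {m L} → IsPacked m L → IsPacked m (promK m L)
  promK-packed packed = IsPacked-cong (λ x → sym (promK≗promoted x)) promoted-packed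
    where open Promotion packed

  promK-OnBranch : ∀ {m L} → IsPacked m L → ∀ i {x} → 2 ≤ x → x ≤ m →
    OnBranch m (promK m L) i x ⇔ OnBranch m L i (rot m x)
  promK-OnBranch {m} packed i 2≤x x≤m = mk⇔
    (promoted-OnBranch⁻ i ∘′ OnBranch-cong m promK≗promoted i _)
    (OnBranch-cong m (λ y → sym (promK≗promoted y)) i _ ∘′ promoted-OnBranch⁺ i 2≤x x≤m)
    where open Promotion packed

  iter-promK-packed : ∀ {m L} s → IsPacked m L → IsPacked m (iter s (promK m) L)
  iter-promK-packed zero    packed = packed
  iter-promK-packed (suc s) packed = promK-packed (iter-promK-packed s packed)

  iter-promK-OnBranch : ∀ {m L} s → IsPacked m L → ∀ i {x} → 2 ≤ x → x ≤ m →
    OnBranch m (iter s (promK m) L) i x ⇔ OnBranch m L i (iter s (rot m) x)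
  iter-promK-OnBranch zero    _      _ _   _   = mk⇔ id id
  iter-promK-OnBranch {m} {L} (suc s) packed i {x} 2≤x x≤m = mk⇔
    (subst (OnBranch m L i) rot-commutes ∘′ Equivalence.to IH ∘′ Equivalence.to step)
    (Equivalence.from step ∘′ Equivalence.from IH ∘′ subst (OnBranch m L i) (sym rot-commutes))
    where
    rot-commutes : iter s (rot m) (rot m x) ≡ iter (suc s) (rot m) x
    rot-commutes = iter-pull s (rot m) x
    step : OnBranch m (promK m (iter s (promK m) L)) i x ⇔ OnBranch m (iter s (promK m) L) i (rot m x)
    step = promK-OnBranch (iter-promK-packed s packed) i 2≤x x≤m
    IH : OnBranch m (iter s (promK m) L) i (rot m x) ⇔ OnBranch m L i (iter s (rot m) (rot m x))
    IH = iter-promK-OnBranch s packed i (proj₁ (rot-range 2≤x x≤m)) (proj₂ (rot-range 2≤x x≤m))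

  OnBranch-determines : ∀ {m L L'} → IsPacked m L → IsPacked m L' →
    (∀ i {x} → 2 ≤ x → x ≤ m → OnBranch m L i x ⇔ OnBranch m L' i x) → L ≗ L'
  OnBranch-determines packed packed' same nothing = trans P.root-label (sym P'.root-label)
    where
    module P = Packed packed
    module P' = Packed packed'
  OnBranch-determines {m} {L} {L'} packed packed' same (just (i , j)) = begin
    L (just (i , j))               ≡⟨ sym (branchLabel-toℕ m L i j) ⟩
    branchLabel m L i (toℕ j)      ≡⟨ increasing-image-injective (P.branch-increasing i) (P'.branch-increasing i) L⊆L' L'⊆L (toℕ<n j) ⟩
    branchLabel m L' i (toℕ j)     ≡⟨ branchLabel-toℕ m L' i j ⟩
    L' (just (i , j))              ∎
    where
    open ≡-Reasoning
    module P = Packed packed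
    module P' = Packed packed'
    L⊆L' : ImageBelow-⊆ (b i) (branchLabel m L i) (branchLabel m L' i)
    L⊆L' s<b = Equivalence.to (same i (P.branch-≥2 i _) (P.branch-≤ i _ s<b)) (_ , s<b , refl)
    L'⊆L : ImageBelow-⊆ (b i) (branchLabel m L' i) (branchLabel m L i)
    L'⊆L s<b = Equivalence.from (same i (P'.branch-≥2 i _) (P'.branch-≤ i _ s<b)) (_ , s<b , refl)

  promK-period : ∀ m → FixesAll k b m (m ∸ 1)
  promK-period m L packed = OnBranch-determines (iter-promK-packed (m ∸ 1) packed) packed λ i {x} 2≤x x≤m →
    subst (λ y → OnBranch m (iter (m ∸ 1) (promK m) L) i x ⇔ OnBranch m L i y) (iter-rot-period 2≤x x≤m)
      (iter-promK-OnBranch (m ∸ 1) packed i 2≤x x≤m)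

  promK-fixes-full : ∀ m → (∀ i → b i ≡ m ∸ 1) → FixesAll k b m 1
  promK-fixes-full m full L packed = OnBranch-determines (promK-packed packed) packed λ i 2≤x x≤m →
    mk⇔ (λ _ → Packed.full-branch-OnBranch packed i (full i) _ 2≤x x≤m)
        (λ _ → Packed.full-branch-OnBranch (promK-packed packed) i (full i) _ 2≤x x≤m)

  -- A labeling of period m − 1

  updateBranch : (Fin k → ℕ → ℕ) → Fin k → ℕ → ℕ → Fin k → ℕ → ℕ
  updateBranch g i p v i' = if ⌊ i' ≟ i ⌋ then update (g i') p v else g i'

  updateBranch-same : ∀ g i p v t → updateBranch g i p v i t ≡ update (g i) p v t
  updateBranch-same g i p v t = cong-app (if-true (Fin-≟-refl i)) t

  updateBranch-other : ∀ g {i} p v {i'} t → i' ≢ i → updateBranch g i p v i' t ≡ g i' t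
  updateBranch-other g {i} p v {i'} t i'≢i with i' ≟ i
  ... | yes i'≡i = contradiction i'≡i i'≢i
  ... | no _     = refl

  updateBranch-kept : ∀ g i p v i' t → g i' t ≢ g i p → updateBranch g i p v i' t ≡ g i' t
  updateBranch-kept g i p v i' t differs with i' ≟ i
  ... | yes refl = update-≢ (g i) v (differs ∘′ cong (g i))
  ... | no _     = refl

  updateBranch-range : ∀ {m} g i p v → (∀ i' t → t < b i' → 2 ≤ g i' t × g i' t ≤ m) → 2 ≤ v × v ≤ m →
    ∀ i' t → t < b i' → 2 ≤ updateBranch g i p v i' t × updateBranch g i p v i' t ≤ m
  updateBranch-range g i p v range v-range i' t t<b with i' ≟ i | t ≟ℕ p
  ... | yes refl | yes refl rewrite update-≡ (g i) p v = v-range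
  ... | yes refl | no t≢p   rewrite update-≢ (g i) v t≢p = range i t t<b
  ... | no _     | _        = range i' t t<b

  updateBranch-increasing : ∀ g i p v → (∀ i' → IncreasingBelow (b i') (g i')) → p < b i → Adjacent (g i p) v →
    (∀ {t} → t < b i → g i t ≢ v) → ∀ i' → IncreasingBelow (b i') (updateBranch g i p v i')
  updateBranch-increasing g i p v g↑ p<b adjacent avoids i' with i' ≟ i
  ... | yes refl = update-increasing (g↑ i) p<b adjacent avoids
  ... | no _     = g↑ i'

  -- Were L' fixed, rot^s y would lie on branch i of L' at some position t. At t = p this makes
  -- y a fixed point of rot^s; elsewhere rot^s y is on branch i of L, which is also fixed, so y is too.
  exchange-not-fixed : ∀ {m s L L'} i {p y} → 1 ≤ s → s < m ∸ 1 → IsPacked m L → IsPacked m L' →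
    FixesAll k b m s → 2 ≤ y → y ≤ m → ¬ OnBranch m L i y → p < b i →
    (∀ t → t < b i → branchLabel m L' i t ≡ update (branchLabel m L i) p y t) → ⊥
  exchange-not-fixed {m} {s} {L} {L'} i {p} {y} 1≤s s<m-1 packed packed' fixes 2≤y y≤m missing p<b exchanged
    with Equivalence.to (iter-promK-OnBranch s packed' i 2≤y y≤m)
                        (OnBranch-cong m (λ x → sym (fixes L' packed' x)) i y (p , p<b , at-p))
    where
    at-p : branchLabel m L' i p ≡ y
    at-p = trans (exchanged p p<b) (update-≡ (branchLabel m L i) p y)
  ... | t , t<b , at-t with t ≟ℕ p
  ... | yes refl = iter-rot-no-fixpoint 1≤s s<m-1 2≤y y≤m (trans (sym at-t) (trans (exchanged t t<b) (update-≡ (branchLabel m L i) t y)))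
  ... | no t≢p   = missing (OnBranch-cong m (fixes L packed) i y (Equivalence.from (iter-promK-OnBranch s packed i 2≤y y≤m)
    (t , t<b , trans (sym (trans (exchanged t t<b) (update-≢ (branchLabel m L i) y t≢p))) at-t)))

  module Exchange {m : ℕ} {L : Labeling k b} (packed : IsPacked m L) (i : Fin k) where

    open Packed packed
    private
      ℓ : Fin k → ℕ → ℕ
      ℓ = branchLabel m L

    record MissingNeighbour : Set where
      field
        p y      : ℕ
        p<b      : p < b i
        2≤y      : 2 ≤ y
        y≤m      : y ≤ m
        missing  : ¬ OnBranch m L i y
        adjacent : Adjacent (ℓ i p) y

    below-bottom : 1 ≤ b i → ℓ i 0 ≢ 2 → MissingNeighbour
    below-bottom 1≤b ℓ0≢2 = record
      { p = 0 ; y = ℓ i 0 ∸ 1 ; p<b = 1≤b ; 2≤y = ∸-monoˡ-≤ 1 3≤ℓ0 ; y≤m = ≤-trans (m∸n≤m _ 1) (branch-≤ i 0 1≤b)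
      ; missing = missing ; adjacent = inj₁ ℓ0≡y+1 }
      where
      3≤ℓ0 : 3 ≤ ℓ i 0
      3≤ℓ0 = ≤∧≢⇒< (branch-≥2 i 0) (ℓ0≢2 ∘′ sym)
      ℓ0≡y+1 : ℓ i 0 ≡ suc (ℓ i 0 ∸ 1)
      ℓ0≡y+1 = sym (m+[n∸m]≡n (≤-trans (s≤s z≤n) 3≤ℓ0))
      missing : ¬ OnBranch m L i (ℓ i 0 ∸ 1)
      missing (t , _ , ℓt≡y) = <⇒≱ (subst (_≤ ℓ i t) ℓ0≡y+1 (branch-mono i z≤n)) (≤-reflexive ℓt≡y)

    above-jump : ∀ p → p < b i → suc (ℓ i p) < ℓ i (suc p) → MissingNeighbour
    above-jump p p<b jump = record
      { p = p ; y = suc (ℓ i p) ; p<b = p<b ; 2≤y = m≤n⇒m≤1+n (branch-≥2 i p)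
      ; y≤m = ≤-pred (<-≤-trans jump (branch-≤1+ i _))
      ; missing = missing ; adjacent = inj₂ refl }
      where
      missing : ¬ OnBranch m L i (suc (ℓ i p))
      missing (t , _ , ℓt≡y) with t ≤? p
      ... | yes t≤p = <⇒≱ (s≤s (branch-mono i t≤p)) (≤-reflexive (sym ℓt≡y))
      ... | no t≰p  = <⇒≱ (<-≤-trans jump (branch-mono i (≰⇒> t≰p))) (≤-reflexive ℓt≡y)

    -- Without a missing neighbour the branch reads 2, 3, …, b i + 1, and its sentinel m + 1
    -- at position b i would be at most b i + 2 ≤ m.
    missing-neighbour : 1 ≤ b i → b i < m ∸ 1 → MissingNeighbour
    missing-neighbour 1≤b b<m-1 with ℓ i 0 ≟ℕ 2
    ... | no ℓ0≢2  = below-bottom 1≤b ℓ0≢2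
    ... | yes ℓ0≡2 with anyUpTo? (λ p → suc (ℓ i p) <? ℓ i (suc p)) (b i)
    ...   | yes (p , p<b , jump) = above-jump p p<b jump
    ...   | no no-jump = contradiction (≤-trans (≤-reflexive (sym top)) (ℓ≤2+ (b i) ≤-refl)) (<⇒≱ (s≤s 2+b≤m))
      where
      ℓ≤2+ : ∀ t → t ≤ b i → ℓ i t ≤ 2 + t
      ℓ≤2+ zero    _      = ≤-reflexive ℓ0≡2
      ℓ≤2+ (suc t) t+1≤b  = ≤-trans (≮⇒≥ (λ jump → no-jump (t , t+1≤b , jump))) (s≤s (ℓ≤2+ t (<⇒≤ t+1≤b)))
      top : ℓ i (b i) ≡ suc m
      top = branchLabel-≮ m L i (b i) (<-irrefl refl)
      2+b≤m : 2 + b i ≤ m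
      2+b≤m = ≤-trans (s≤s b<m-1) (≤-reflexive (m+[n∸m]≡n 1≤m))

    -- Put y on branch i in place of a = ℓ i p. The branch j that carried y takes a in y's place,
    -- unless it already carries a, so that both labels remain in use.
    module Relabel (gap : MissingNeighbour) where

      open MissingNeighbour gap

      private
        a : ℕ
        a = ℓ i p
        range : ∀ i' t → t < b i' → 2 ≤ ℓ i' t × ℓ i' t ≤ m
        range i' t t<b = branch-≥2 i' t , branch-≤ i' t t<b
        g₁ : Fin k → ℕ → ℕ
        g₁ = updateBranch ℓ i p y

      y-site : ∃ λ j → OnBranch m L j y
      y-site = label-on-branch y 2≤y y≤m

      j : Fin k
      j = proj₁ y-site
      q : ℕ
      q = proj₁ (proj₂ y-site)
      q<b : q < b j
      q<b = proj₁ (proj₂ (proj₂ y-site))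
      ℓq≡y : ℓ j q ≡ y
      ℓq≡y = proj₂ (proj₂ (proj₂ y-site))

      j≢i : j ≢ i
      j≢i j≡i = missing (subst (λ i' → OnBranch m L i' y) j≡i (proj₂ y-site))

      on-fromBranches : ∀ g i' t {l} → t < b i' → g i' t ≡ l → OnBranch m (fromBranches g) i' l
      on-fromBranches g i' t t<b eq = t , t<b , trans (branchLabel-fromBranches m g i' t t<b) eq

      g₁-range : ∀ i' t → t < b i' → 2 ≤ g₁ i' t × g₁ i' t ≤ m
      g₁-range = updateBranch-range ℓ i p y range (2≤y , y≤m)
      g₁-increasing : ∀ i' → IncreasingBelow (b i') (g₁ i')
      g₁-increasing = updateBranch-increasing ℓ i p y branch-increasing p<b adjacent (λ t<b eq → missing (_ , t<b , eq))

      g₁-y : g₁ i p ≡ y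
      g₁-y = trans (updateBranch-same ℓ i p y p) (update-≡ (ℓ i) p y)

      g₁-j : ∀ t → g₁ j t ≡ ℓ j t
      g₁-j t = updateBranch-other ℓ p y t j≢i

      g₁-at-y-site : ∀ {l} i' t → g₁ i' t ≡ l → g₁ i' t ≡ g₁ j q → l ≡ y
      g₁-at-y-site i' t g₁t≡l eq = trans (sym g₁t≡l) (trans eq (trans (g₁-j q) ℓq≡y))

      g₁-kept : ∀ {l} i' t → ℓ i' t ≡ l → l ≢ a → g₁ i' t ≡ l
      g₁-kept i' t ℓt≡l l≢a = trans (updateBranch-kept ℓ i p y i' t (l≢a ∘′ trans (sym ℓt≡l))) ℓt≡l

      Relabelled : Set
      Relabelled = ∃ λ L' → IsPacked m L' × (∀ t → t < b i → branchLabel m L' i t ≡ update (ℓ i) p y t)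

      relabelled-a-kept : OnBranch m L j a → Relabelled
      relabelled-a-kept (r , r<b , ℓr≡a) =
        fromBranches g₁ , fromBranches-packed g₁ 1≤m g₁-range g₁-increasing covered ,
        λ t t<b → trans (branchLabel-fromBranches m g₁ i t t<b) (updateBranch-same ℓ i p y t)
        where
        covered : ∀ l → 2 ≤ l → l ≤ m → ∃ λ i' → OnBranch m (fromBranches g₁) i' l
        covered l 2≤l l≤m with l ≟ℕ y | l ≟ℕ a
        ... | yes refl | _        = i , on-fromBranches g₁ i p p<b g₁-y
        ... | no _     | yes refl = j , on-fromBranches g₁ j r r<b (trans (g₁-j r) ℓr≡a)
        ... | no _     | no l≢a   = let (i' , t , t<b , ℓt≡l) = label-on-branch l 2≤l l≤m
                                    in i' , on-fromBranches g₁ i' t t<b (g₁-kept i' t ℓt≡l l≢a)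

      relabelled-a-moved : ¬ OnBranch m L j a → Relabelled
      relabelled-a-moved a-missing =
        fromBranches g₂ , fromBranches-packed g₂ 1≤m g₂-range g₂-increasing covered ,
        λ t t<b → trans (branchLabel-fromBranches m g₂ i t t<b)
                        (trans (updateBranch-other g₁ q a t (j≢i ∘′ sym)) (updateBranch-same ℓ i p y t))
        where
        g₂ : Fin k → ℕ → ℕ
        g₂ = updateBranch g₁ j q a
        g₂-range : ∀ i' t → t < b i' → 2 ≤ g₂ i' t × g₂ i' t ≤ m
        g₂-range = updateBranch-range g₁ j q a g₁-range (branch-≥2 i p , branch-≤ i p p<b)
        g₂-increasing : ∀ i' → IncreasingBelow (b i') (g₂ i')
        g₂-increasing = updateBranch-increasing g₁ j q a g₁-increasing q<b
          (subst (λ z → Adjacent z a) (sym (trans (g₁-j q) ℓq≡y)) (Adjacent-sym adjacent))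
          (λ t<b eq → a-missing (_ , t<b , trans (sym (g₁-j _)) eq))
        covered : ∀ l → 2 ≤ l → l ≤ m → ∃ λ i' → OnBranch m (fromBranches g₂) i' l
        covered l 2≤l l≤m with l ≟ℕ y | l ≟ℕ a
        ... | yes refl | _        = i , on-fromBranches g₂ i p p<b (trans (updateBranch-other g₁ q a p (j≢i ∘′ sym)) g₁-y)
        ... | no _     | yes refl = j , on-fromBranches g₂ j q q<b (trans (updateBranch-same g₁ j q a q) (update-≡ (g₁ j) q a))
        ... | no l≢y   | no l≢a   = let (i' , t , t<b , ℓt≡l) = label-on-branch l 2≤l l≤m
                                        g₁t≡l = g₁-kept i' t ℓt≡l l≢a
                                    in i' , on-fromBranches g₂ i' t t<b
                                      (trans (updateBranch-kept g₁ j q a i' t (l≢y ∘′ g₁-at-y-site i' t g₁t≡l)) g₁t≡l)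

      relabelled : Relabelled
      relabelled with anyUpTo? (λ t → ℓ j t ≟ℕ a) (b j)
      ... | yes a-on-j = relabelled-a-kept a-on-j
      ... | no a-off-j = relabelled-a-moved a-off-j

  promK-no-shorter-period : ∀ {m L} → IsPacked m L → ∀ i → 1 ≤ b i → b i < m ∸ 1 →
    ∀ s → 1 ≤ s → s < m ∸ 1 → ¬ FixesAll k b m s
  promK-no-shorter-period packed i 1≤b b<m-1 s 1≤s s<m-1 fixes =
    let (_ , packed' , exchanged) = relabelled
    in exchange-not-fixed i 1≤s s<m-1 packed packed' fixes 2≤y y≤m missing p<b exchanged
    where
    open Exchange packed i
    open MissingNeighbour (missing-neighbour 1≤b b<m-1)
    open Relabel (missing-neighbour 1≤b b<m-1) using (relabelled)

theorem3p1 : (k : ℕ) (b : Fin k → ℕ) → (∀ i → 1 ≤ b i) → (m : ℕ) → 1 ≤ m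
           → (∃ λ (L : Labeling k b) → IsPacked m L)
           → ((∀ i → b i ≡ m ∸ 1) → IsOrderOfPromK k b m 1)
           × (¬ (∀ i → b i ≡ m ∸ 1) → IsOrderOfPromK k b m (m ∸ 1))
theorem3p1 k b 1≤b m _ (L , packed) = all-full , not-all-full
  where
  all-full : (∀ i → b i ≡ m ∸ 1) → IsOrderOfPromK k b m 1
  all-full full = ≤-refl , promK-fixes-full m full , λ s 1≤s s<1 _ → <⇒≱ s<1 1≤s
  not-all-full : ¬ (∀ i → b i ≡ m ∸ 1) → IsOrderOfPromK k b m (m ∸ 1)
  not-all-full some-short with ¬∀⟶∃¬ k _ (λ i → b i ≟ℕ m ∸ 1) some-short
  ... | i , b≢m-1 = ≤-trans (1≤b i) (<⇒≤ b<m-1) , promK-period m , promK-no-shorter-period packed i (1≤b i) b<m-1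
    where
    b<m-1 : b i < m ∸ 1
    b<m-1 = ≤∧≢⇒< (Packed.branch-length-≤ packed i) b≢m-1
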